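{- Let $G$ be an oriented co-graph. Then $\chi_o(G)\leq\Delta(G)+1$.
   Context: For vertex-disjoint digraphs $G_1=(V_1,E_1)$, $G_2=(V_2,E_2)$: the disjoint union $G_1\oplus G_2=(V_1\cup V_2,E_1\cup E_2)$; the order composition $G_1\oslash G_2$ is the disjoint union plus all arcs $(u,v)$ with $u\in V_1$, $v\in V_2$. Oriented co-graphs are defined recursively: every single-vertex digraph is an oriented co-graph, and if $G_1,G_2$ are vertex-disjoint oriented co-graphs then $G_1\oplus G_2$ and $G_1\oslash G_2$ are oriented co-graphs. $\Delta(G)=\max_{v}(\mathrm{indegree}(v)+\mathrm{outdegree}(v))$. An oriented $r$-coloring of an oriented graph $G=(V,E)$ is a map $c:V\to\{1,\dots,r\}$ with $c(u)\neq c(v)$ for every $(u,v)\in E$, and $c(u)\neq c(y)$ for every two arcs $(u,v),(x,y)\in E$ with $c(v)=c(x)$; $\chi_o(G)$ is the smallest such $r$. -}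

module Defs where

open import Data.Nat using (ℕ; zero; suc; _+_; _⊔_; _≤_)
open import Data.Fin using (Fin; splitAt)
open import Data.Sum using (inj₁; inj₂)
open import Data.Bool using (Bool; true; false; if_then_else_)
open import Data.List using (List; map; foldr; allFin)
open import Data.Nat.ListAction using (sum)
open import Data.Product using (Σ; ∃; _×_)
open import Function.Bundles using (_↔_; Inverse)
open import Relation.Binary.PropositionalEquality using (_≡_; _≢_)

Digraph : ℕ → Set
Digraph n = Fin n → Fin n → Bool

_⊕_ : ∀ {m n} → Digraph m → Digraph n → Digraph (m + n)
_⊕_ {m} E₁ E₂ u v with splitAt m u | splitAt m v
... | inj₁ a | inj₁ b = E₁ a b
... | inj₂ a | inj₂ b = E₂ a b
... | _      | _      = false

_⊘_ : ∀ {m n} → Digraph m → Digraph n → Digraph (m + n)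
_⊘_ {m} E₁ E₂ u v with splitAt m u | splitAt m v
... | inj₁ a | inj₁ b = E₁ a b
... | inj₂ a | inj₂ b = E₂ a b
... | inj₁ _ | inj₂ _ = true
... | inj₂ _ | inj₁ _ = false

single : Digraph 1
single _ _ = false

-- Oriented co-graphs, defined recursively; since the vertex set is always
-- Fin n, we close under relabelling of vertices (isomorphism), which is how
-- "every single-vertex digraph" and "vertex-disjoint G₁, G₂" are rendered.
data OrientedCograph : ∀ {n} → Digraph n → Set where
  cg-single : OrientedCograph single
  cg-union  : ∀ {m n} {E₁ : Digraph m} {E₂ : Digraph n} →
              OrientedCograph E₁ → OrientedCograph E₂ → OrientedCograph (E₁ ⊕ E₂)
  cg-order  : ∀ {m n} {E₁ : Digraph m} {E₂ : Digraph n} →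
              OrientedCograph E₁ → OrientedCograph E₂ → OrientedCograph (E₁ ⊘ E₂)
  cg-iso    : ∀ {n} {E E′ : Digraph n} (π : Fin n ↔ Fin n) →
              OrientedCograph E →
              (∀ u v → E′ u v ≡ E (Inverse.to π u) (Inverse.to π v)) →
              OrientedCograph E′

toℕ : Bool → ℕ
toℕ true  = 1
toℕ false = 0

degree : ∀ {n} → Digraph n → Fin n → ℕ
degree {n} E v = sum (map (λ w → toℕ (E v w) + toℕ (E w v)) (allFin n))

Δ : ∀ {n} → Digraph n → ℕ
Δ {n} E = foldr _⊔_ 0 (map (degree E) (allFin n))

IsOrientedColoring : ∀ {n} (E : Digraph n) (r : ℕ) → (Fin n → Fin r) → Set
IsOrientedColoring E r c =
  (∀ u v → E u v ≡ true → c u ≢ c v) ×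
  (∀ u v x y → E u v ≡ true → E x y ≡ true → c v ≡ c x → c u ≢ c y)

χo≤ : ∀ {n} → Digraph n → ℕ → Set
χo≤ {n} E k = Σ ℕ λ r → r ≤ k × Σ (Fin n → Fin r) (IsOrientedColoring E r)

module Submission where

-- Rank every vertex so that ranks strictly increase along arcs and never exceed
-- the in-degree; such a rank is an oriented colouring with at most Δ + 1 colours.
-- Co-graphs admit one: in G₁ ⊘ G₂ shift the ranks of G₂ by |V₁|, which every vertex
-- of G₂ gains in in-degree; the other constructions leave ranks and in-degrees alone.

open import Defs
open import Data.Nat using (ℕ; zero; suc; _+_; _⊔_; _≤_; _<_; z≤n; s≤s)
open import Data.Nat.Properties
open import Data.Fin as Fin using (Fin; zero; suc; _↑ˡ_; _↑ʳ_; splitAt; fromℕ<)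
open import Data.Fin.Properties using (splitAt-↑ˡ; splitAt-↑ʳ; toℕ-fromℕ<)
open import Data.Sum using (inj₁; inj₂)
open import Data.Bool using (true)
open import Data.List using (List; foldr; tabulate)
open import Data.List.Properties using (map-tabulate)
open import Data.List.Membership.Propositional using (_∈_)
open import Data.List.Membership.Propositional.Properties using (∈-map⁺; ∈-allFin)
open import Data.List.Relation.Unary.Any using (here; there)
import Data.Nat.ListAction as List
open import Data.Vec.Functional using (_++_)
open import Data.Vec.Functional.Properties using (lookup-++ˡ; lookup-++ʳ)
open import Data.Product using (_,_)
open import Function using (_∘_; id; _↔_; Inverse)
open import Relation.Binary.PropositionalEquality
open import Algebra.Properties.CommutativeMonoid.Sum +-0-commutativeMonoid
  using (sum-syntax; sum-cong-≗; ∑-distrib-+; ∑-permute)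

∑-splitAt : ∀ m {n} (h : Fin (m + n) → ℕ) →
            ∑[ i < m + n ] h i ≡ ∑[ i < m ] h (i ↑ˡ n) + ∑[ j < n ] h (m ↑ʳ j)
∑-splitAt zero    h = refl
∑-splitAt (suc m) h = trans (cong (h zero +_) (∑-splitAt m (h ∘ suc))) (sym (+-assoc (h zero) _ _))

∑-1 : ∀ n → ∑[ i < n ] 1 ≡ n
∑-1 zero    = refl
∑-1 (suc n) = cong suc (∑-1 n)

sum-tabulate : ∀ {n} (h : Fin n → ℕ) → List.sum (tabulate h) ≡ ∑[ i < n ] h i
sum-tabulate {zero}  h = refl
sum-tabulate {suc n} h = cong (h zero +_) (sum-tabulate (h ∘ suc))

∈⇒≤-foldr-⊔ : ∀ {x : ℕ} {xs : List ℕ} → x ∈ xs → x ≤ foldr _⊔_ 0 xs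
∈⇒≤-foldr-⊔ (here refl)  = m≤m⊔n _ _
∈⇒≤-foldr-⊔ (there x∈xs) = ≤-trans (∈⇒≤-foldr-⊔ x∈xs) (m≤n⊔m _ _)

indegree : ∀ {n} → Digraph n → Fin n → ℕ
indegree {n} E v = ∑[ w < n ] toℕ (E w v)

indegree≤degree : ∀ {n} (E : Digraph n) v → indegree E v ≤ degree E v
indegree≤degree {n} E v = begin
  indegree E v                        ≤⟨ m≤n+m _ _ ⟩
  ∑[ w < n ] out w + ∑[ w < n ] in′ w ≡⟨ ∑-distrib-+ out in′ ⟨
  ∑[ w < n ] (out w + in′ w)          ≡⟨ sum-tabulate out+in ⟨
  List.sum (tabulate out+in)          ≡⟨ cong List.sum (map-tabulate id out+in) ⟨
  degree E v                          ∎
  where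
  open ≤-Reasoning
  out in′ out+in : Fin n → ℕ
  out w = toℕ (E v w)
  in′ w = toℕ (E w v)
  out+in w = out w + in′ w

degree≤Δ : ∀ {n} (E : Digraph n) v → degree E v ≤ Δ E
degree≤Δ E v = ∈⇒≤-foldr-⊔ (∈-map⁺ (degree E) (∈-allFin v))

module _ m {n} (E : Digraph (m + n)) (v : Fin (m + n)) where

  indegree-↑ : indegree E v ≡ ∑[ w < m ] toℕ (E (w ↑ˡ n) v) + ∑[ w < n ] toℕ (E (m ↑ʳ w) v)
  indegree-↑ = ∑-splitAt m (λ w → toℕ (E w v))

  ∑ˡ≤indegree : ∑[ w < m ] toℕ (E (w ↑ˡ n) v) ≤ indegree E v
  ∑ˡ≤indegree = ≤-trans (m≤m+n _ _) (≤-reflexive (sym indegree-↑))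

  ∑ʳ≤indegree : ∑[ w < n ] toℕ (E (m ↑ʳ w) v) ≤ indegree E v
  ∑ʳ≤indegree = ≤-trans (m≤n+m _ _) (≤-reflexive (sym indegree-↑))

data Split m n : Fin (m + n) → Set where
  ↑ˡ-split : (a : Fin m) → Split m n (a ↑ˡ n)
  ↑ʳ-split : (b : Fin n) → Split m n (m ↑ʳ b)

split : ∀ m {n} (u : Fin (m + n)) → Split m n u
split zero    u       = ↑ʳ-split u
split (suc m) zero    = ↑ˡ-split zero
split (suc m) (suc u) with split m u
... | ↑ˡ-split a = ↑ˡ-split (suc a)
... | ↑ʳ-split b = ↑ʳ-split b

module _ {m n} (E₁ : Digraph m) (E₂ : Digraph n) where

  ⊕-↑ˡ : ∀ a b → (E₁ ⊕ E₂) (a ↑ˡ n) (b ↑ˡ n) ≡ E₁ a b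
  ⊕-↑ˡ a b rewrite splitAt-↑ˡ m a n | splitAt-↑ˡ m b n = refl

  ⊕-↑ʳ : ∀ a b → (E₁ ⊕ E₂) (m ↑ʳ a) (m ↑ʳ b) ≡ E₂ a b
  ⊕-↑ʳ a b rewrite splitAt-↑ʳ m n a | splitAt-↑ʳ m n b = refl

  ⊘-↑ˡ : ∀ a b → (E₁ ⊘ E₂) (a ↑ˡ n) (b ↑ˡ n) ≡ E₁ a b
  ⊘-↑ˡ a b rewrite splitAt-↑ˡ m a n | splitAt-↑ˡ m b n = refl

  ⊘-↑ʳ : ∀ a b → (E₁ ⊘ E₂) (m ↑ʳ a) (m ↑ʳ b) ≡ E₂ a b
  ⊘-↑ʳ a b rewrite splitAt-↑ʳ m n a | splitAt-↑ʳ m n b = refl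

  ⊘-↑ˡ↑ʳ : ∀ a b → (E₁ ⊘ E₂) (a ↑ˡ n) (m ↑ʳ b) ≡ true
  ⊘-↑ˡ↑ʳ a b rewrite splitAt-↑ˡ m a n | splitAt-↑ʳ m n b = refl

  indegree-⊕-↑ˡ : ∀ a → indegree E₁ a ≤ indegree (E₁ ⊕ E₂) (a ↑ˡ n)
  indegree-⊕-↑ˡ a = ≤-trans (≤-reflexive (sum-cong-≗ λ w → cong toℕ (sym (⊕-↑ˡ w a))))
                            (∑ˡ≤indegree m (E₁ ⊕ E₂) (a ↑ˡ n))

  indegree-⊕-↑ʳ : ∀ b → indegree E₂ b ≤ indegree (E₁ ⊕ E₂) (m ↑ʳ b)
  indegree-⊕-↑ʳ b = ≤-trans (≤-reflexive (sum-cong-≗ λ w → cong toℕ (sym (⊕-↑ʳ w b))))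
                            (∑ʳ≤indegree m (E₁ ⊕ E₂) (m ↑ʳ b))

  indegree-⊘-↑ˡ : ∀ a → indegree E₁ a ≤ indegree (E₁ ⊘ E₂) (a ↑ˡ n)
  indegree-⊘-↑ˡ a = ≤-trans (≤-reflexive (sum-cong-≗ λ w → cong toℕ (sym (⊘-↑ˡ w a))))
                            (∑ˡ≤indegree m (E₁ ⊘ E₂) (a ↑ˡ n))

  indegree-⊘-↑ʳ : ∀ b → m + indegree E₂ b ≡ indegree (E₁ ⊘ E₂) (m ↑ʳ b)
  indegree-⊘-↑ʳ b = begin
    m + indegree E₂ b                                  ≡⟨ cong (_+ indegree E₂ b) (∑-1 m) ⟨
    ∑[ w < m ] 1 + indegree E₂ b                       ≡⟨ cong₂ _+_ (sum-cong-≗ λ w → cong toℕ (⊘-↑ˡ↑ʳ w b))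
                                                                     (sum-cong-≗ λ w → cong toℕ (⊘-↑ʳ w b)) ⟨
    ∑[ w < m ] toℕ ((E₁ ⊘ E₂) (w ↑ˡ n) (m ↑ʳ b))
      + ∑[ w < n ] toℕ ((E₁ ⊘ E₂) (m ↑ʳ w) (m ↑ʳ b))   ≡⟨ indegree-↑ m (E₁ ⊘ E₂) (m ↑ʳ b) ⟨
    indegree (E₁ ⊘ E₂) (m ↑ʳ b)                        ∎
    where open ≡-Reasoning

record Ranking {n} (E : Digraph n) : Set where
  field
    rank            : Fin n → ℕ
    rank<order      : ∀ v → rank v < n
    rank≤indegree   : ∀ v → rank v ≤ indegree E v
    rank-increasing : ∀ u v → E u v ≡ true → rank u < rank v

open Ranking

ranking-single : Ranking single
ranking-single = record
  { rank            = λ _ → 0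
  ; rank<order      = λ _ → s≤s z≤n
  ; rank≤indegree   = λ _ → z≤n
  ; rank-increasing = λ _ _ ()
  }

module _ {m n} {E₁ : Digraph m} {E₂ : Digraph n} (R₁ : Ranking E₁) (R₂ : Ranking E₂) where

  ranking-⊕ : Ranking (E₁ ⊕ E₂)
  ranking-⊕ = record
    { rank            = ρ
    ; rank<order      = bounded
    ; rank≤indegree   = below-indegree
    ; rank-increasing = increasing
    }
    where
    ρ : Fin (m + n) → ℕ
    ρ = rank R₁ ++ rank R₂

    bounded : ∀ v → ρ v < m + n
    bounded v with split m v
    ... | ↑ˡ-split a rewrite lookup-++ˡ (rank R₁) (rank R₂) a = ≤-trans (rank<order R₁ a) (m≤m+n m n)
    ... | ↑ʳ-split b rewrite lookup-++ʳ (rank R₁) (rank R₂) b = ≤-trans (rank<order R₂ b) (m≤n+m n m)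

    below-indegree : ∀ v → ρ v ≤ indegree (E₁ ⊕ E₂) v
    below-indegree v with split m v
    ... | ↑ˡ-split a rewrite lookup-++ˡ (rank R₁) (rank R₂) a =
      ≤-trans (rank≤indegree R₁ a) (indegree-⊕-↑ˡ E₁ E₂ a)
    ... | ↑ʳ-split b rewrite lookup-++ʳ (rank R₁) (rank R₂) b =
      ≤-trans (rank≤indegree R₂ b) (indegree-⊕-↑ʳ E₁ E₂ b)

    increasing : ∀ u v → (E₁ ⊕ E₂) u v ≡ true → ρ u < ρ v
    increasing u v e with splitAt m u | splitAt m v
    ... | inj₁ a | inj₁ b = rank-increasing R₁ a b e
    ... | inj₂ a | inj₂ b = rank-increasing R₂ a b e

  ranking-⊘ : Ranking (E₁ ⊘ E₂)
  ranking-⊘ = record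
    { rank            = ρ
    ; rank<order      = bounded
    ; rank≤indegree   = below-indegree
    ; rank-increasing = increasing
    }
    where
    ρ : Fin (m + n) → ℕ
    ρ = rank R₁ ++ (m +_) ∘ rank R₂

    bounded : ∀ v → ρ v < m + n
    bounded v with split m v
    ... | ↑ˡ-split a rewrite lookup-++ˡ (rank R₁) ((m +_) ∘ rank R₂) a =
      ≤-trans (rank<order R₁ a) (m≤m+n m n)
    ... | ↑ʳ-split b rewrite lookup-++ʳ (rank R₁) ((m +_) ∘ rank R₂) b =
      +-monoʳ-< m (rank<order R₂ b)

    below-indegree : ∀ v → ρ v ≤ indegree (E₁ ⊘ E₂) v
    below-indegree v with split m v
    ... | ↑ˡ-split a rewrite lookup-++ˡ (rank R₁) ((m +_) ∘ rank R₂) a =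
      ≤-trans (rank≤indegree R₁ a) (indegree-⊘-↑ˡ E₁ E₂ a)
    ... | ↑ʳ-split b rewrite lookup-++ʳ (rank R₁) ((m +_) ∘ rank R₂) b =
      ≤-trans (+-monoʳ-≤ m (rank≤indegree R₂ b)) (≤-reflexive (indegree-⊘-↑ʳ E₁ E₂ b))

    increasing : ∀ u v → (E₁ ⊘ E₂) u v ≡ true → ρ u < ρ v
    increasing u v e with splitAt m u | splitAt m v
    ... | inj₁ a | inj₁ b = rank-increasing R₁ a b e
    ... | inj₁ a | inj₂ b = ≤-trans (rank<order R₁ a) (m≤m+n m (rank R₂ b))
    ... | inj₂ a | inj₂ b = +-monoʳ-< m (rank-increasing R₂ a b e)

ranking-relabel : ∀ {n} {E E′ : Digraph n} (π : Fin n ↔ Fin n) → Ranking E →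
                  (∀ u v → E′ u v ≡ E (Inverse.to π u) (Inverse.to π v)) → Ranking E′
ranking-relabel {n} {E} {E′} π R E′≡E∘π = record
  { rank            = rank R ∘ to
  ; rank<order      = rank<order R ∘ to
  ; rank≤indegree   = λ v → ≤-trans (rank≤indegree R (to v)) (≤-reflexive (indegree-relabel v))
  ; rank-increasing = λ u v e → rank-increasing R (to u) (to v) (trans (sym (E′≡E∘π u v)) e)
  }
  where
  open Inverse π using (to)
  indegree-relabel : ∀ v → indegree E (to v) ≡ indegree E′ v
  indegree-relabel v = begin
    ∑[ w < n ] toℕ (E w (to v))      ≡⟨ ∑-permute (λ w → toℕ (E w (to v))) π ⟩
    ∑[ w < n ] toℕ (E (to w) (to v)) ≡⟨ sum-cong-≗ (λ w → cong toℕ (E′≡E∘π w v)) ⟨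
    ∑[ w < n ] toℕ (E′ w v)          ∎
    where open ≡-Reasoning

ranking : ∀ {n} {E : Digraph n} → OrientedCograph E → Ranking E
ranking cg-single         = ranking-single
ranking (cg-union G₁ G₂)  = ranking-⊕ (ranking G₁) (ranking G₂)
ranking (cg-order G₁ G₂)  = ranking-⊘ (ranking G₁) (ranking G₂)
ranking (cg-iso π G E′≡E) = ranking-relabel π (ranking G) E′≡E

increasing⇒oriented : ∀ {n r} (E : Digraph n) (c : Fin n → Fin r) →
                      (∀ u v → E u v ≡ true → Fin.toℕ (c u) < Fin.toℕ (c v)) →
                      IsOrientedColoring E r c
increasing⇒oriented E c increasing = proper , oriented
  where
  proper : ∀ u v → E u v ≡ true → c u ≢ c v
  proper u v e cu≡cv = <-irrefl (cong Fin.toℕ cu≡cv) (increasing u v e)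
  oriented : ∀ u v x y → E u v ≡ true → E x y ≡ true → c v ≡ c x → c u ≢ c y
  oriented u v x y e₁ e₂ cv≡cx cu≡cy = <-irrefl (cong Fin.toℕ cu≡cy) (begin-strict
    Fin.toℕ (c u) <⟨ increasing u v e₁ ⟩
    Fin.toℕ (c v) ≡⟨ cong Fin.toℕ cv≡cx ⟩
    Fin.toℕ (c x) <⟨ increasing x y e₂ ⟩
    Fin.toℕ (c y) ∎)
    where open ≤-Reasoning

corollary4p8 : ∀ {n} (E : Digraph n) → OrientedCograph E → χo≤ E (suc (Δ E))
corollary4p8 {n} E G = suc (Δ E) , ≤-refl , colour , increasing⇒oriented E colour increasing
  where
  R = ranking G
  rank<1+Δ : ∀ v → rank R v < suc (Δ E)
  rank<1+Δ v = s≤s (≤-trans (rank≤indegree R v) (≤-trans (indegree≤degree E v) (degree≤Δ E v)))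
  colour : Fin n → Fin (suc (Δ E))
  colour v = fromℕ< (rank<1+Δ v)
  increasing : ∀ u v → E u v ≡ true → Fin.toℕ (colour u) < Fin.toℕ (colour v)
  increasing u v e = subst₂ _<_ (sym (toℕ-fromℕ< (rank<1+Δ u))) (sym (toℕ-fromℕ< (rank<1+Δ v)))
                            (rank-increasing R u v e)
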